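{- Let $\mathbb{F}_q$ be a finite field, $m\ge 1$, and let $L$ be a set of monomials in $R=\mathbb{F}_q[x_1,\ldots,x_m]$, each of degree less than $q$ in every variable, such that $L$ is closed under divisibility and has the Borel property. Then every lower triangular affine transformation $T(x)=Ax+b$ (with $A$ an invertible lower triangular $m\times m$ matrix over $\mathbb{F}_q$ and $b\in\mathbb{F}_q^m$) is an affine permutation of the code $L(\mathbb{F}_q^m)$; i.e. $\mathrm{LTA}_m\subseteq \mathrm{Perm}_A(L(\mathbb{F}_q^m))$.
   Context: For a Cartesian set $\mathcal{A}=\prod_{i=1}^m A_i$ with $A_i\subseteq\mathbb{F}_q$, $n_i=|A_i|\ge 2$, let $\Delta$ be the set of monomials $u$ with $\deg_{x_i}u<n_i$ for all $i$; for $L\subseteq\Delta$ the monomial Cartesian code is $L(\mathcal{A})=\mathrm{Span}_{\mathbb{F}_q}\{(f(P_1),\ldots,f(P_n)) : f\in L\}$ where $\mathcal{A}=\{P_1,\ldots,P_n\}$. The vanishing ideal of $\mathcal{A}$ is $I_{\mathcal{A}}=\left(\prod_{\alpha\in A_j}(x_j-\alpha)\right)_{j=1}^m$, and for $g\in R$, $\overline{g}$ denotes the unique polynomial in $\mathrm{Span}_{\mathbb{F}_q}(\Delta)$ with $g-\overline{g}\in I_{\mathcal{A}}$. An affine transformation $T(x)=Ax+b$ ($A$ an $m\times m$ matrix over $\mathbb{F}_q$, $b\in\mathbb{F}_q^m$) acts on points by $P\mapsto AP+b$ and on polynomials by $T(f)=f(y_1,\ldots,y_m)$ where $(y_1,\ldots,y_m)^t=A(x_1,\ldots,x_m)^t+b$.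 $T$ is an affine permutation of $L(\mathcal{A})$ if (1) $T(\mathcal{A})=\mathcal{A}$ and (2) $\overline{T(f)}\in\mathrm{Span}_{\mathbb{F}_q}(L)$ for every $f\in L$; the set of these is $\mathrm{Perm}_A(L(\mathcal{A}))$. Here $\mathcal{A}=\mathbb{F}_q^m$. A monomial set $L$ has the Borel property if whenever $u\in L$, $x_i\mid u$ and $j<i$, the monomial $\frac{x_j}{x_i}u$ is in $L$. $\mathrm{LTA}_m$ denotes the set of affine transformations $Ax+b$ with $A$ invertible lower triangular. -}

module Defs where

open import Level using (Level; _⊔_) renaming (suc to lsuc; zero to lzero)
open import Algebra.Bundles using (CommutativeRing)
open import Data.Nat as ℕ using (ℕ; zero; suc; _%_; _∸_; _<_; _≤_)
open import Data.Fin using (Fin; toℕ) renaming (_≟_ to _≟ᶠ_)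
open import Data.Vec using (Vec; lookup; replicate; tabulate; updateAt; zipWith)
import Data.Vec as V
open import Data.Vec.Properties using (≡-dec)
open import Data.List using (List; []; _∷_; _++_; length; concatMap; foldr)
import Data.List as Li
open import Data.List.Relation.Unary.Any using (Any)
open import Data.List.Relation.Unary.AllPairs using (AllPairs)
open import Data.Product using (Σ; _×_; _,_; ∃)
open import Relation.Nullary using (¬_; yes; no)
open import Relation.Binary using (Decidable)
open import Relation.Binary.PropositionalEquality using (_≡_)

record FiniteField (c ℓ : Level) : Set (lsuc (c ⊔ ℓ)) where
  field
    commRing : CommutativeRing c ℓ
  open CommutativeRing commRing public
  field
    _≟_      : Decidable _≈_
    1≉0      : ¬ (1# ≈ 0#)
    inverse  : ∀ x → ¬ (x ≈ 0#) → Σ Carrier (λ y → (x * y) ≈ 1#)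
    elems    : List Carrier
    complete : ∀ x → Any (x ≈_) elems
    distinct : AllPairs (λ x y → ¬ (x ≈ y)) elems

  q : ℕ
  q = length elems

module FFDefs {c ℓ : Level} (F : FiniteField c ℓ) where
  open FiniteField F using (Carrier; _≈_; _+_; _*_; 0#; 1#; q)

  sumF : ∀ {n} → (Fin n → Carrier) → Carrier
  sumF {zero}  f = 0#
  sumF {suc n} f = f Fin.zero + sumF (λ i → f (Fin.suc i))
    where import Data.Fin as Fin

  Matrix : ℕ → Set c
  Matrix m = Fin m → Fin m → Carrier

  _·_ : ∀ {m} → Matrix m → Matrix m → Matrix m
  (A · B) i j = sumF (λ k → A i k * B k j)

  idMat : ∀ {m} → Matrix m
  idMat i j with i ≟ᶠ j
  ... | yes _ = 1#
  ... | no  _ = 0#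

  LowerTriangular : ∀ {m} → Matrix m → Set ℓ
  LowerTriangular {m} A = ∀ (i j : Fin m) → toℕ i < toℕ j → A i j ≈ 0#

  Invertible : ∀ {m} → Matrix m → Set (c ⊔ ℓ)
  Invertible {m} A = Σ (Matrix m) λ B →
    (∀ i j → (A · B) i j ≈ idMat i j) × (∀ i j → (B · A) i j ≈ idMat i j)

  record Affine (m : ℕ) : Set c where
    constructor affine
    field
      mat : Matrix m
      vec : Fin m → Carrier
  open Affine public

  applyPt : ∀ {m} → Affine m → (Fin m → Carrier) → (Fin m → Carrier)
  applyPt T P i = sumF (λ j → mat T i j * P j) + vec T i

  Mono : ℕ → Set
  Mono m = Vec ℕ m

  Poly : ℕ → Set c
  Poly m = List (Carrier × Mono m)

  constP : ∀ {m} → Carrier → Poly m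
  constP a = (a , replicate _ 0) ∷ []

  unitExp : ∀ {m} → Fin m → Mono m
  unitExp j = tabulate δ
    where
      δ : _ → ℕ
      δ k with k ≟ᶠ j
      ... | yes _ = 1
      ... | no  _ = 0

  monoP : ∀ {m} → Mono m → Poly m
  monoP e = (1# , e) ∷ []

  addP : ∀ {m} → Poly m → Poly m → Poly m
  addP = _++_

  mulP : ∀ {m} → Poly m → Poly m → Poly m
  mulP p r = concatMap (λ { (a , e) → Li.map (λ { (b , e′) → (a * b , zipWith ℕ._+_ e e′) }) r }) p

  powP : ∀ {m} → Poly m → ℕ → Poly m
  powP p zero    = constP 1#
  powP p (suc n) = mulP p (powP p n)

  prodF : ∀ {m n} → (Fin n → Poly m) → Poly m
  prodF {n = zero}  f = constP 1#
  prodF {n = suc n} f = mulP (f Fin.zero) (prodF (λ i → f (Fin.suc i)))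
    where import Data.Fin as Fin

  sumP : ∀ {m n} → (Fin n → Poly m) → Poly m
  sumP {n = zero}  f = []
  sumP {n = suc n} f = addP (f Fin.zero) (sumP (λ i → f (Fin.suc i)))
    where import Data.Fin as Fin

  linForm : ∀ {m} → Affine m → Fin m → Poly m
  linForm T i = addP (sumP (λ j → (mat T i j , unitExp j) ∷ [])) (constP (vec T i))

  substMono : ∀ {m} → Affine m → Mono m → Poly m
  substMono T e = prodF (λ i → powP (linForm T i) (lookup e i))

  applyPoly : ∀ {m} → Affine m → Poly m → Poly m
  applyPoly T f = concatMap (λ { (a , e) → mulP (constP a) (substMono T e) }) f

  -- Normal form modulo I_A for A = F_q^m: here Π_{α∈F_q}(x_j - α) = x_j^q - x_j,
  -- so x^e reduces to x^(redExp e) with redExp 0 = 0, redExp (k+1) = 1 + (k mod (q-1)).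
  redExp : ℕ → ℕ
  redExp zero = zero
  redExp (suc k) with q ∸ 1
  ... | zero  = suc k
  ... | suc r = suc (k % suc r)

  reduce : ∀ {m} → Poly m → Poly m
  reduce p = Li.map (λ { (a , e) → (a , V.map redExp e) }) p

  coeff : ∀ {m} → Poly m → Mono m → Carrier
  coeff p e = foldr (λ { (a , e′) acc → step a e′ acc }) 0# p
    where
      step : Carrier → Mono _ → Carrier → Carrier
      step a e′ acc with ≡-dec ℕ._≟_ e′ e
      ... | yes _ = a + acc
      ... | no  _ = acc

  InDelta : ∀ {m} → Mono m → Set
  InDelta {m} e = ∀ (i : Fin m) → lookup e i < q

  DivClosed : ∀ {m} → (Mono m → Set) → Set
  DivClosed {m} L = ∀ (e e′ : Mono m) → L e → (∀ i → lookup e′ i ≤ lookup e i) → L e′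

  Borel : ∀ {m} → (Mono m → Set) → Set
  Borel {m} L = ∀ (e : Mono m) (i j : Fin m) → L e → 1 ≤ lookup e i → toℕ j < toℕ i →
    L (updateAt (updateAt e i ℕ.pred) j suc)

  InSpan : ∀ {m} → (Mono m → Set) → Poly m → Set ℓ
  InSpan {m} L g = ∀ (e : Mono m) → ¬ L e → coeff g e ≈ 0#

  IsAffinePerm : ∀ {m} → (Mono m → Set) → Affine m → Set (c ⊔ ℓ)
  IsAffinePerm {m} L T =
    (∀ (Q : Fin m → Carrier) → Σ (Fin m → Carrier) λ P → ∀ i → applyPt T P i ≈ Q i)
    × (∀ (f : Mono m) → L f → InSpan L (reduce (applyPoly T (monoP f))))

module Submission where

-- Lower triangularity makes each substituted variable y_i = Σ_{j ≤ i} a_ij x_j + b_i a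
-- combination of x_i, of monomials x_j with j < i (Borel shifts of x_i), and of a
-- constant (a divisor of x_i).  Being reachable by Borel shifts and divisions is
-- compatible with multiplication of monomials, so every monomial of T(x^e) is reachable
-- from x^e, and so is every monomial of its reduction, which only lowers exponents.  A
-- divisor-closed Borel set L is closed under reachability, hence the reduction of T(x^e)
-- lies in Span(L) whenever x^e ∈ L.  The point condition T(F_q^m) = F_q^m holds since T
-- has the inverse P ↦ A⁻¹(P − b).

open import Level using (Level; _⊔_)
open import Algebra.Bundles using (Monoid)
open import Data.Nat using (ℕ; zero; suc; _≤_; _<_; z≤n; s≤s)
open import Data.Fin using (Fin; zero; suc; toℕ)
import Data.Fin.Properties as Finₚ
open import Data.Product using (Σ; _,_; proj₁; proj₂)
open import Data.Vec as Vec using (Vec; _∷_; lookup; replicate; updateAt; zipWith)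
open import Function using (_∘_; _∋_)
open import Relation.Binary.PropositionalEquality as ≡ using (_≡_; _≢_; refl)
open import Defs

module _ {a ℓ} (M : Monoid a ℓ) where
  open Monoid M
  open import Algebra.Properties.Monoid.Sum M using (sum; sum-cong-≋; sum-replicate-zero)

  sum-zero : ∀ {n} (h : Fin n → Carrier) → (∀ i → h i ≈ ε) → sum h ≈ ε
  sum-zero {n} h h≈ε = trans (sum-cong-≋ h≈ε) (sum-replicate-zero n)

  sum-single : ∀ {n} (h : Fin n → Carrier) k → (∀ i → i ≢ k → h i ≈ ε) → sum h ≈ h k
  sum-single h zero    h≈ε = trans (∙-congˡ (sum-zero (h ∘ suc) (λ i → h≈ε (suc i) λ ()))) (identityʳ _)
  sum-single h (suc k) h≈ε = trans (∙-congʳ (h≈ε zero λ ()))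
    (trans (identityˡ _) (sum-single (h ∘ suc) k (λ i i≢k → h≈ε (suc i) (i≢k ∘ Finₚ.suc-injective))))

module Exponents where
  open import Data.Nat using (_+_; _*_; pred)
  import Data.Nat.Properties as ℕₚ
  open import Data.Vec.Properties using (lookup-zipWith; lookup-replicate; lookup∘updateAt; zipWith-comm; zipWith-identityˡ)
  import Relation.Binary.Construct.Closure.ReflexiveTransitive as Star
  open Star using (Star; _◅_; _◅◅_)
  open import Algebra.Properties.Monoid.Sum ℕₚ.+-0-monoid using (sum)
  open ≡.≡-Reasoning

  infixl 6 _⊕_
  infix 4 _≤ᵛ_ _⇝_

  _⊕_ : ∀ {m} → Vec ℕ m → Vec ℕ m → Vec ℕ m
  _⊕_ = zipWith _+_

  0ᵛ : ∀ {m} → Vec ℕ m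
  0ᵛ = replicate _ 0

  _≤ᵛ_ : ∀ {m} → Vec ℕ m → Vec ℕ m → Set
  u ≤ᵛ v = ∀ k → lookup u k ≤ lookup v k

  lookup-⊕ : ∀ {m} (u v : Vec ℕ m) k → lookup (u ⊕ v) k ≡ lookup u k + lookup v k
  lookup-⊕ u v k = lookup-zipWith _+_ k u v

  ⊕-comm : ∀ {m} (u v : Vec ℕ m) → u ⊕ v ≡ v ⊕ u
  ⊕-comm = zipWith-comm ℕₚ.+-comm

  u≤ᵛu⊕v : ∀ {m} (u v : Vec ℕ m) → u ≤ᵛ u ⊕ v
  u≤ᵛu⊕v u v k = ≡.subst (lookup u k ≤_) (≡.sym (lookup-⊕ u v k)) (ℕₚ.m≤m+n _ _)

  ⊕-monoˡ-≤ᵛ : ∀ {m} {u u′ : Vec ℕ m} v → u′ ≤ᵛ u → u′ ⊕ v ≤ᵛ u ⊕ v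
  ⊕-monoˡ-≤ᵛ {u = u} {u′} v u′≤u k =
    ≡.subst₂ _≤_ (≡.sym (lookup-⊕ u′ v k)) (≡.sym (lookup-⊕ u v k)) (ℕₚ.+-monoˡ-≤ (lookup v k) (u′≤u k))

  -- (x_j / x_i) x^e, written exactly as in Borel so that Borel applies to it as it stands.
  shiftExp : ∀ {m} → Vec ℕ m → Fin m → Fin m → Vec ℕ m
  shiftExp e i j = updateAt (updateAt e i pred) j suc

  updateAt-⊕ : ∀ {m} i (u v : Vec ℕ m) {φ ψ : ℕ → ℕ} →
    φ (lookup u i) + lookup v i ≡ ψ (lookup u i + lookup v i) →
    updateAt u i φ ⊕ v ≡ updateAt (u ⊕ v) i ψ
  updateAt-⊕ zero    (x ∷ u) (y ∷ v) eq = ≡.cong (_∷ u ⊕ v) eq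
  updateAt-⊕ (suc i) (x ∷ u) (y ∷ v) eq = ≡.cong (x + y ∷_) (updateAt-⊕ i u v eq)

  shiftExp-⊕ : ∀ {m} (u v : Vec ℕ m) i j → 1 ≤ lookup u i → shiftExp u i j ⊕ v ≡ shiftExp (u ⊕ v) i j
  shiftExp-⊕ u v i j 1≤uᵢ = begin
    updateAt (updateAt u i pred) j suc ⊕ v    ≡⟨ updateAt-⊕ j (updateAt u i pred) v refl ⟩
    updateAt (updateAt u i pred ⊕ v) j suc    ≡⟨ ≡.cong (λ w → updateAt w j suc) lowered ⟩
    updateAt (updateAt (u ⊕ v) i pred) j suc  ∎
    where
    pred-+ : ∀ {a b} → 1 ≤ a → pred a + b ≡ pred (a + b)
    pred-+ (s≤s _) = refl

    lowered : updateAt u i pred ⊕ v ≡ updateAt (u ⊕ v) i pred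
    lowered = updateAt-⊕ i u v (pred-+ 1≤uᵢ)

  data BorelStep {m} (e : Vec ℕ m) : Vec ℕ m → Set where
    lower : ∀ {e′} → e′ ≤ᵛ e → BorelStep e e′
    shift : ∀ i j → 1 ≤ lookup e i → toℕ j < toℕ i → BorelStep e (shiftExp e i j)

  _⇝_ : ∀ {m} → Vec ℕ m → Vec ℕ m → Set
  _⇝_ = Star BorelStep

  ⇝-refl : ∀ {m} {e : Vec ℕ m} → e ⇝ e
  ⇝-refl = Star.ε

  ≤ᵛ⇒⇝ : ∀ {m} {e e′ : Vec ℕ m} → e′ ≤ᵛ e → e ⇝ e′
  ≤ᵛ⇒⇝ e′≤e = lower e′≤e ◅ Star.ε

  BorelStep-⊕ʳ : ∀ {m} {u u′ : Vec ℕ m} v → BorelStep u u′ → BorelStep (u ⊕ v) (u′ ⊕ v)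
  BorelStep-⊕ʳ {u = u} {u′} v (lower u′≤u) = lower (⊕-monoˡ-≤ᵛ {u = u} {u′} v u′≤u)
  BorelStep-⊕ʳ {u = u} v (shift i j 1≤uᵢ j<i) =
    ≡.subst (BorelStep (u ⊕ v)) (≡.sym (shiftExp-⊕ u v i j 1≤uᵢ))
      (shift i j (ℕₚ.≤-trans 1≤uᵢ (u≤ᵛu⊕v u v i)) j<i)

  ⇝-⊕ʳ : ∀ {m} {u u′ : Vec ℕ m} v → u ⇝ u′ → u ⊕ v ⇝ u′ ⊕ v
  ⇝-⊕ʳ v = Star.gmap (_⊕ v) (BorelStep-⊕ʳ v)

  ⇝-⊕ : ∀ {m} {u u′ v v′ : Vec ℕ m} → u ⇝ u′ → v ⇝ v′ → u ⊕ v ⇝ u′ ⊕ v′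
  ⇝-⊕ {u′ = u′} {v} {v′} u⇝u′ v⇝v′ =
    ⇝-⊕ʳ v u⇝u′ ◅◅ ≡.subst₂ _⇝_ (⊕-comm v u′) (⊕-comm v′ u′) (⇝-⊕ʳ u′ v⇝v′)

  infixr 7 _·ᵛ_

  _·ᵛ_ : ∀ {m} → ℕ → Vec ℕ m → Vec ℕ m
  zero  ·ᵛ u = 0ᵛ
  suc n ·ᵛ u = u ⊕ n ·ᵛ u

  ∑ᵛ : ∀ {m n} → (Fin n → Vec ℕ m) → Vec ℕ m
  ∑ᵛ {n = zero}  t = 0ᵛ
  ∑ᵛ {n = suc n} t = t zero ⊕ ∑ᵛ (t ∘ suc)

  lookup-·ᵛ : ∀ {m} n (u : Vec ℕ m) k → lookup (n ·ᵛ u) k ≡ n * lookup u k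
  lookup-·ᵛ zero    u k = lookup-replicate k 0
  lookup-·ᵛ (suc n) u k = ≡.trans (lookup-⊕ u (n ·ᵛ u) k) (≡.cong (lookup u k +_) (lookup-·ᵛ n u k))

  lookup-∑ᵛ : ∀ {m n} (t : Fin n → Vec ℕ m) k → lookup (∑ᵛ t) k ≡ sum (λ i → lookup (t i) k)
  lookup-∑ᵛ {n = zero}  t k = lookup-replicate k 0
  lookup-∑ᵛ {n = suc n} t k =
    ≡.trans (lookup-⊕ (t zero) (∑ᵛ (t ∘ suc)) k) (≡.cong (lookup (t zero) k +_) (lookup-∑ᵛ (t ∘ suc) k))

  ⊕-identityˡ : ∀ {m} (u : Vec ℕ m) → 0ᵛ ⊕ u ≡ u
  ⊕-identityˡ = zipWith-identityˡ ℕₚ.+-identityˡ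

  0ᵛ≤ᵛ : ∀ {m} (u : Vec ℕ m) → 0ᵛ ≤ᵛ u
  0ᵛ≤ᵛ u k = ≡.subst (_≤ lookup u k) (≡.sym (lookup-replicate k 0)) z≤n

  lookup-shiftExp-target : ∀ {m} (e : Vec ℕ m) i j → 1 ≤ lookup (shiftExp e i j) j
  lookup-shiftExp-target e i j = ≡.subst (1 ≤_) (≡.sym (lookup∘updateAt j (updateAt e i pred))) (s≤s z≤n)

open Exponents

module _ {c ℓ} (F : FiniteField c ℓ) where
  open FiniteField F hiding (refl; sym; trans; _≟_; zero)
  open FiniteField F using () renaming (refl to ≈-refl; sym to ≈-sym; trans to ≈-trans)
  open FFDefs F
  open import Data.Nat using (_<?_)
  import Data.Nat as ℕ
  import Data.Nat.Properties as ℕₚ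
  open import Data.Fin using () renaming (_≟_ to _≟ᶠ_)
  open import Data.Vec.Properties using (lookup∘tabulate; lookup-map; ≡-dec)
  open import Data.List using ([]; _∷_)
  open import Data.List.Relation.Unary.All as All using (All; []; _∷_)
  open import Data.List.Relation.Unary.All.Properties using (++⁺; map⁺)
  open import Data.Sum as Sum using (_⊎_; inj₁; inj₂)
  open import Data.Nat.DivMod using (m%n≤m)
  open import Relation.Nullary using (yes; no)
  open import Relation.Binary.Construct.Closure.ReflexiveTransitive using (ε; _◅_; _◅◅_)
  open import Data.Empty using (⊥-elim)

  ⇝-closed : ∀ {m} {L : Mono m → Set} → DivClosed L → Borel L → ∀ {e e′} → L e → e ⇝ e′ → L e′
  ⇝-closed dc bor Le ε = Le
  ⇝-closed dc bor Le (lower e′≤e ◅ steps) = ⇝-closed dc bor (dc _ _ Le e′≤e) steps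
  ⇝-closed dc bor Le (shift i j 1≤eᵢ j<i ◅ steps) = ⇝-closed dc bor (bor _ i j Le 1≤eᵢ j<i) steps

  lookup-unitExp-≡ : ∀ {m} (j : Fin m) → lookup (unitExp j) j ≡ 1
  lookup-unitExp-≡ j with j ≟ᶠ j | (lookup (unitExp j) j ≡ _ ∋ lookup∘tabulate _ j)
  ... | yes _  | eq = eq
  ... | no j≢j | _  = ⊥-elim (j≢j refl)

  lookup-unitExp-≢ : ∀ {m} (j k : Fin m) → k ≢ j → lookup (unitExp j) k ≡ 0
  lookup-unitExp-≢ j k k≢j with k ≟ᶠ j | (lookup (unitExp j) k ≡ _ ∋ lookup∘tabulate _ k)
  ... | yes k≡j | _  = ⊥-elim (k≢j k≡j)
  ... | no _    | eq = eq

  unitExp-≤ᵛ : ∀ {m} j (v : Mono m) → 1 ≤ lookup v j → unitExp j ≤ᵛ v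
  unitExp-≤ᵛ j v 1≤vⱼ k with k ≟ᶠ j
  ... | yes refl = ≡.subst (_≤ lookup v k) (≡.sym (lookup-unitExp-≡ k)) 1≤vⱼ
  ... | no k≢j   = ≡.subst (_≤ lookup v k) (≡.sym (lookup-unitExp-≢ j k k≢j)) z≤n

  unitExp-⇝ : ∀ {m} {i j : Fin m} → toℕ j ≤ toℕ i → unitExp i ⇝ unitExp j
  unitExp-⇝ {i = i} {j} j≤i with ℕₚ.m≤n⇒m<n∨m≡n j≤i
  ... | inj₁ j<i = shift i j (ℕₚ.≤-reflexive (≡.sym (lookup-unitExp-≡ i))) j<i
                 ◅ ≤ᵛ⇒⇝ (unitExp-≤ᵛ j (shiftExp (unitExp i) i j) (lookup-shiftExp-target (unitExp i) i j))
  ... | inj₂ j≡i rewrite Finₚ.toℕ-injective j≡i = ⇝-refl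

  lookup-∑ᵛ-unitExp : ∀ {m} (e : Mono m) k → lookup (∑ᵛ (λ i → lookup e i ·ᵛ unitExp i)) k ≡ lookup e k
  lookup-∑ᵛ-unitExp e k = begin
    lookup (∑ᵛ (λ i → lookup e i ·ᵛ unitExp i)) k  ≡⟨ lookup-∑ᵛ (λ i → lookup e i ·ᵛ unitExp i) k ⟩
    sum (λ i → lookup (lookup e i ·ᵛ unitExp i) k)  ≡⟨ sum-single ℕₚ.+-0-monoid _ k vanishing ⟩
    lookup (lookup e k ·ᵛ unitExp k) k              ≡⟨ lookup-·ᵛ (lookup e k) (unitExp k) k ⟩
    lookup e k ℕ.* lookup (unitExp k) k             ≡⟨ ≡.cong (lookup e k ℕ.*_) (lookup-unitExp-≡ k) ⟩
    lookup e k ℕ.* 1                                ≡⟨ ℕₚ.*-identityʳ (lookup e k) ⟩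
    lookup e k                                      ∎
    where
    open ≡.≡-Reasoning
    open import Algebra.Properties.Monoid.Sum ℕₚ.+-0-monoid using (sum)

    vanishing : ∀ i → i ≢ k → lookup (lookup e i ·ᵛ unitExp i) k ≡ 0
    vanishing i i≢k = begin
      lookup (lookup e i ·ᵛ unitExp i) k   ≡⟨ lookup-·ᵛ (lookup e i) (unitExp i) k ⟩
      lookup e i ℕ.* lookup (unitExp i) k  ≡⟨ ≡.cong (lookup e i ℕ.*_) (lookup-unitExp-≢ i k (i≢k ∘ ≡.sym)) ⟩
      lookup e i ℕ.* 0                     ≡⟨ ℕₚ.*-zeroʳ (lookup e i) ⟩
      0                                    ∎

  Supported : ∀ {m} → (Mono m → Set) → Poly m → Set (c ⊔ ℓ)
  Supported S = All (λ t → proj₁ t ≈ 0# ⊎ S (proj₂ t))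

  Supported-map : ∀ {m} {S S′ : Mono m → Set} → (∀ {e} → S e → S′ e) →
    ∀ {p} → Supported S p → Supported S′ p
  Supported-map S⊆S′ = All.map (Sum.map₂ S⊆S′)

  constP-supported : ∀ {m} {S : Mono m → Set} a → S 0ᵛ → Supported S (constP a)
  constP-supported a S0 = inj₂ S0 ∷ []

  mulP-supported : ∀ {m} {S₁ S₂ S : Mono m → Set} → (∀ {u v} → S₁ u → S₂ v → S (u ⊕ v)) →
    ∀ {p r} → Supported S₁ p → Supported S₂ r → Supported S (mulP p r)
  mulP-supported combine {[]}          []           _  = []
  mulP-supported {S₁ = S₁} {S₂} {S} combine {(a , u) ∷ p} (sᵤ ∷ sₚ) sᵣ =
    ++⁺ (map⁺ (All.map (term sᵤ) sᵣ)) (mulP-supported combine sₚ sᵣ)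
    where
    term : a ≈ 0# ⊎ S₁ u → ∀ {t} → proj₁ t ≈ 0# ⊎ S₂ (proj₂ t) → a * proj₁ t ≈ 0# ⊎ S (u ⊕ proj₂ t)
    term (inj₁ a≈0) {b , _} _          = inj₁ (≈-trans (*-congʳ a≈0) (zeroˡ b))
    term (inj₂ _)   {b , _} (inj₁ b≈0) = inj₁ (≈-trans (*-congˡ b≈0) (zeroʳ a))
    term (inj₂ S₁u)         (inj₂ S₂v) = inj₂ (combine S₁u S₂v)

  sumP-supported : ∀ {m n} {S : Mono m → Set} {ps : Fin n → Poly m} →
    (∀ i → Supported S (ps i)) → Supported S (sumP ps)
  sumP-supported {n = zero}  _  = []
  sumP-supported {n = suc n} sₚ = ++⁺ (sₚ zero) (sumP-supported (sₚ ∘ suc))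

  powP-supported : ∀ {m} {u : Mono m} {p} n → Supported (u ⇝_) p → Supported (n ·ᵛ u ⇝_) (powP p n)
  powP-supported zero    _  = constP-supported 1# ⇝-refl
  powP-supported (suc n) sₚ = mulP-supported ⇝-⊕ sₚ (powP-supported n sₚ)

  prodF-supported : ∀ {m n} (t : Fin n → Mono m) {ps : Fin n → Poly m} →
    (∀ i → Supported (t i ⇝_) (ps i)) → Supported (∑ᵛ t ⇝_) (prodF ps)
  prodF-supported {n = zero}  t _  = constP-supported 1# ⇝-refl
  prodF-supported {n = suc n} t sₚ = mulP-supported ⇝-⊕ (sₚ zero) (prodF-supported (t ∘ suc) (sₚ ∘ suc))

  linForm-supported : ∀ {m} (T : Affine m) → LowerTriangular (mat T) →
    ∀ i → Supported (unitExp i ⇝_) (linForm T i)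
  linForm-supported T lower-triangular i =
    ++⁺ (sumP-supported variable-term) (constP-supported (vec T i) (≤ᵛ⇒⇝ (0ᵛ≤ᵛ (unitExp i))))
    where
    variable-term : ∀ j → Supported (unitExp i ⇝_) ((mat T i j , unitExp j) ∷ [])
    variable-term j with toℕ i <? toℕ j
    ... | yes i<j = inj₁ (lower-triangular i j i<j) ∷ []
    ... | no i≮j  = inj₂ (unitExp-⇝ (ℕₚ.≮⇒≥ i≮j)) ∷ []

  substMono-supported : ∀ {m} (T : Affine m) → LowerTriangular (mat T) →
    ∀ e → Supported (e ⇝_) (substMono T e)
  substMono-supported T lower-triangular e =
    Supported-map (≤ᵛ⇒⇝ (λ k → ℕₚ.≤-reflexive (lookup-∑ᵛ-unitExp e k)) ◅◅_)
      (prodF-supported _ (λ i → powP-supported (lookup e i) (linForm-supported T lower-triangular i)))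

  applyPoly-monoP-supported : ∀ {m} {S : Mono m → Set} (T : Affine m) e →
    Supported S (substMono T e) → Supported S (applyPoly T (monoP e))
  applyPoly-monoP-supported {S = S} T e sₑ =
    ++⁺ (mulP-supported unit (constP-supported {S = _≡ 0ᵛ} 1# refl) sₑ) []
    where
    unit : ∀ {u v} → u ≡ 0ᵛ → S v → S (u ⊕ v)
    unit refl Sv = ≡.subst S (≡.sym (⊕-identityˡ _)) Sv

  redExp-≤ : ∀ k → redExp k ≤ k
  redExp-≤ zero = z≤n
  redExp-≤ (suc k) with q ℕ.∸ 1
  ... | zero  = ℕₚ.≤-refl
  ... | suc r = s≤s (m%n≤m k (suc r))

  map-redExp-≤ᵛ : ∀ {m} (u : Mono m) → Vec.map redExp u ≤ᵛ u
  map-redExp-≤ᵛ u k = ≡.subst (_≤ lookup u k) (≡.sym (lookup-map k redExp u)) (redExp-≤ (lookup u k))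

  reduce-supported : ∀ {m} {e : Mono m} {p} → Supported (e ⇝_) p → Supported (e ⇝_) (reduce p)
  reduce-supported = map⁺ ∘ All.map (λ {t} → Sum.map₂ (_◅◅ ≤ᵛ⇒⇝ (map-redExp-≤ᵛ (proj₂ t))))

  Supported⇒InSpan : ∀ {m} {L : Mono m → Set} p → Supported L p → InSpan L p
  Supported⇒InSpan []             []        e ¬Le = ≈-refl
  Supported⇒InSpan ((a , e′) ∷ p) (sₜ ∷ sₚ) e ¬Le with ≡-dec ℕ._≟_ e′ e
  ... | no _ = Supported⇒InSpan p sₚ e ¬Le
  ... | yes refl with sₜ
  ...   | inj₁ a≈0 = ≈-trans (+-cong a≈0 (Supported⇒InSpan p sₚ e ¬Le)) (+-identityˡ 0#)
  ...   | inj₂ Le  = ⊥-elim (¬Le Le)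

  reduce-applyPoly-supported : ∀ {m} (T : Affine m) → LowerTriangular (mat T) →
    ∀ e → Supported (e ⇝_) (reduce (applyPoly T (monoP e)))
  reduce-applyPoly-supported T lower-triangular e =
    reduce-supported (applyPoly-monoP-supported T e (substMono-supported T lower-triangular e))

  module _ where
    open import Algebra.Properties.Semiring.Sum semiring
      using (sum; sum-cong-≋; sum-cong-≗; ∑-comm; *-distribˡ-sum; *-distribʳ-sum)
    open import Algebra.Properties.Group +-group using (//-rightDividesˡ)
    open import Relation.Binary.Reasoning.Setoid setoid

    sumF≡sum : ∀ {n} (h : Fin n → Carrier) → sumF h ≡ sum h
    sumF≡sum {zero}  h = refl
    sumF≡sum {suc n} h = ≡.cong (h zero +_) (sumF≡sum (h ∘ suc))

    sumF-cong : ∀ {n} {g h : Fin n → Carrier} → (∀ i → g i ≈ h i) → sumF g ≈ sumF h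
    sumF-cong {g = g} {h} g≈h = begin
      sumF g ≡⟨ sumF≡sum g ⟩
      sum g  ≈⟨ sum-cong-≋ g≈h ⟩
      sum h  ≡⟨ sumF≡sum h ⟨
      sumF h ∎

    ·-mulVec : ∀ {m} (A B : Matrix m) (v : Fin m → Carrier) i →
      sumF (λ j → A i j * sumF (λ k → B j k * v k)) ≈ sumF (λ k → (A · B) i k * v k)
    ·-mulVec A B v i = begin
      sumF (λ j → A i j * sumF (λ k → B j k * v k))
        ≡⟨ sumF≡sum (λ j → A i j * sumF (λ k → B j k * v k)) ⟩
      sum (λ j → A i j * sumF (λ k → B j k * v k))
        ≡⟨ sum-cong-≗ (λ j → ≡.cong (A i j *_) (sumF≡sum (λ k → B j k * v k))) ⟩
      sum (λ j → A i j * sum (λ k → B j k * v k))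
        ≈⟨ sum-cong-≋ (λ j → *-distribˡ-sum (A i j) (λ k → B j k * v k)) ⟩
      sum (λ j → sum (λ k → A i j * (B j k * v k)))
        ≈⟨ sum-cong-≋ (λ j → sum-cong-≋ (λ k → ≈-sym (*-assoc (A i j) (B j k) (v k)))) ⟩
      sum (λ j → sum (λ k → (A i j * B j k) * v k))
        ≈⟨ ∑-comm (λ j k → (A i j * B j k) * v k) ⟩
      sum (λ k → sum (λ j → (A i j * B j k) * v k))
        ≈⟨ sum-cong-≋ (λ k → *-distribʳ-sum (v k) (λ j → A i j * B j k)) ⟨
      sum (λ k → sum (λ j → A i j * B j k) * v k)
        ≡⟨ sum-cong-≗ (λ k → ≡.cong (_* v k) (sumF≡sum (λ j → A i j * B j k))) ⟨
      sum (λ k → (A · B) i k * v k)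
        ≡⟨ sumF≡sum (λ k → (A · B) i k * v k) ⟨
      sumF (λ k → (A · B) i k * v k)
        ∎

    idMat-diagonal : ∀ {m} (i : Fin m) → idMat i i ≈ 1#
    idMat-diagonal i with i ≟ᶠ i
    ... | yes _  = ≈-refl
    ... | no i≢i = ⊥-elim (i≢i refl)

    idMat-offDiagonal : ∀ {m} {i k : Fin m} → k ≢ i → idMat i k ≈ 0#
    idMat-offDiagonal {i = i} {k} k≢i with i ≟ᶠ k
    ... | yes i≡k = ⊥-elim (k≢i (≡.sym i≡k))
    ... | no _    = ≈-refl

    idMat-mulVec : ∀ {m} (v : Fin m → Carrier) i → sumF (λ k → idMat i k * v k) ≈ v i
    idMat-mulVec v i = begin
      sumF (λ k → idMat i k * v k)  ≡⟨ sumF≡sum (λ k → idMat i k * v k) ⟩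
      sum (λ k → idMat i k * v k)   ≈⟨ sum-single +-monoid (λ k → idMat i k * v k) i off-diagonal ⟩
      idMat i i * v i               ≈⟨ *-congʳ (idMat-diagonal i) ⟩
      1# * v i                      ≈⟨ *-identityˡ (v i) ⟩
      v i                           ∎
      where
      off-diagonal : ∀ k → k ≢ i → idMat i k * v k ≈ 0#
      off-diagonal k k≢i = ≈-trans (*-congʳ (idMat-offDiagonal k≢i)) (zeroˡ (v k))

    applyPt-surjective : ∀ {m} (T : Affine m) → Invertible (mat T) →
      ∀ (Q : Fin m → Carrier) → Σ (Fin m → Carrier) λ P → ∀ i → applyPt T P i ≈ Q i
    applyPt-surjective {m} T (B , AB≈I , _) Q = P , P↦Q
      where
      v P : Fin m → Carrier
      v k = Q k - vec T k
      P j = sumF (λ k → B j k * v k)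

      P↦Q : ∀ i → applyPt T P i ≈ Q i
      P↦Q i = begin
        sumF (λ j → mat T i j * P j) + vec T i        ≈⟨ +-congʳ (·-mulVec (mat T) B v i) ⟩
        sumF (λ k → (mat T · B) i k * v k) + vec T i  ≈⟨ +-congʳ (sumF-cong (λ k → *-congʳ (AB≈I i k))) ⟩
        sumF (λ k → idMat i k * v k) + vec T i        ≈⟨ +-congʳ (idMat-mulVec v i) ⟩
        (Q i - vec T i) + vec T i                     ≈⟨ //-rightDividesˡ (vec T i) (Q i) ⟩
        Q i                                           ∎

theorem1 : ∀ {c ℓ : Level} (F : FiniteField c ℓ) → let open FFDefs F in
    (m : ℕ) → 1 ≤ m → (L : Mono m → Set) →
    (∀ e → L e → InDelta e) → DivClosed L → Borel L →
    (T : Affine m) → LowerTriangular (mat T) → Invertible (mat T) →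
    IsAffinePerm L T
theorem1 F m _ L _ divClosed borel T lower-triangular invertible =
  applyPt-surjective F T invertible ,
  λ e Le → Supported⇒InSpan F _
    (Supported-map F (⇝-closed F divClosed borel Le) (reduce-applyPoly-supported F T lower-triangular e))
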